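{- Let $p\ge 5$ be a prime and $k$ a positive integer. Then $$(-1)^{(p-1)/2}\binom{kp-1}{(p-1)/2}\equiv 4^{k(p-1)} \pmod{p^3}.$$ -}

module Defs where

open import Data.Integer using (ℤ; _-_; +_)
open import Data.Integer.Divisibility using (_∣_)

_≡_[mod_] : ℤ → ℤ → ℤ → Set
a ≡ b [mod m ] = m ∣ (a - b)

module Submission where

-- Write p = 2h + 1 and let a = h!, b and c be the elementary symmetric functions of degree h, h − 1 and
-- h − 2 in 1, …, h. Expanding to second order, ∏_{j ≤ h} (j − x) ≡ a − bx + cx² (mod x³). The two
-- decompositions of 1, …, p − 1 into {j, p − j} and {2j, p − 2j} (j ≤ h) show, after squaring modulo p, that
-- p ∣ b² − 2ac (i.e. Σ_{j ≤ h} j⁻² ≡ 0), and they give the exact identity ∏ (j − p) = 2ʰ ∏ (2j − p).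
-- With T(t) = 4a − 2tbp + t²cp², the first fact yields T(u)T(v) ≡ 4a T(u + v) (mod p³), hence
-- 4a T(1)ⁿ ≡ (4a)ⁿ T(n), and the second yields T(1) ≡ 4a·4ʰ. Taking n = 2k and x = kp, where
-- ∏ (j − kp) = (−1)ʰ h! C(kp − 1, h), gives the congruence after cancelling the unit (4a)²ᵏ⁺¹.

open import Defs
open import Data.Nat as ℕ using (ℕ; zero; suc; _∸_; _/_; _!; NonZero)
open import Data.Nat.Combinatorics using (_C_; nCk≡nPk/k!)
import Data.Nat.Combinatorics.Base as Combinatorics
open Combinatorics using (_P′_)
open import Data.Nat.Combinatorics.Specification using (k!∣nP′k; nP′k≡n!/[n∸k]!; nPk≡n!/[n∸k]!)
open import Data.Nat.DivMod using (_%_; m/n*n≡m; m*n/n≡m; m≡m%n+[m/n]*n; m%n<n)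
import Data.Nat.Properties as ℕ
import Data.Nat.Tactic.RingSolver as ℕ-Solver
import Data.Nat.Divisibility as ℕ
open import Data.Nat.Primality using (Prime; euclidsLemma; prime⇒nonZero; prime⇒nonTrivial; prime⇒irreducible)
open import Data.Integer as ℤ using (ℤ; +_; -[1+_]; _+_; _*_; _-_; -_; _^_; ∣_∣; 0ℤ; 1ℤ)
import Data.Integer.Properties as ℤ
open import Data.Integer.Divisibility using (_∣_)
import Data.Integer.Divisibility.Signed as Signed
open Signed using (divides; ∣ᵤ⇒∣; ∣⇒∣ᵤ)
open import Data.Integer.Tactic.RingSolver using (solve-∀)
open import Data.List using (List; []; _∷_; [_]; _++_; map; length; applyUpTo; applyDownFrom)
open import Data.List.Properties using (reverse-applyUpTo; map-applyUpTo; applyUpTo-∷ʳ; length-applyUpTo; length-map; map-++)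
import Data.List.Relation.Binary.Permutation.Propositional.Properties as ↭ₚ
open ↭ₚ using (↭-reverse; shift; ++⁺ˡ; ++-comm)
open import Data.List.Relation.Binary.Permutation.Propositional as ↭ using (_↭_)
open import Data.List.Relation.Binary.Pointwise as Pointwise using (Pointwise)
open import Data.Product using (_,_; ∃-syntax)
open import Data.Sum using (inj₁; inj₂)
open import Relation.Binary.Bundles using (Setoid)
import Relation.Binary.Reasoning.Setoid
open import Function using (_∘_)
open import Relation.Nullary using (¬_; contradiction)
open import Relation.Binary.PropositionalEquality
  using (_≡_; refl; sym; trans; cong; cong₂; subst; subst₂; module ≡-Reasoning)

-- Congruences

-- Wrapping _≡_[mod_] in a record lets Agda infer a, b and m.
record _≈_[mod_] (a b m : ℤ) : Set where
  constructor mk≈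
  field ≈⇒≡-mod : a ≡ b [mod m ]
open _≈_[mod_] public

infix 4 _≈_[mod_]

module _ {m : ℤ} where

  private
    fromSigned : ∀ {a b} → m Signed.∣ (a - b) → a ≈ b [mod m ]
    fromSigned {a} {b} d = mk≈ (∣⇒∣ᵤ {m} {a - b} d)

    toSigned : ∀ {a b} → a ≈ b [mod m ] → m Signed.∣ (a - b)
    toSigned (mk≈ d) = ∣ᵤ⇒∣ d

  ≡⇒≈-mod : ∀ {a b} q → a - b ≡ q * m → a ≈ b [mod m ]
  ≡⇒≈-mod q eq = fromSigned (divides q eq)

  mod-refl : ∀ {a} → a ≈ a [mod m ]
  mod-refl {a} = ≡⇒≈-mod 0ℤ (a-a≡0*m a m)
    where a-a≡0*m : ∀ a m → a - a ≡ 0ℤ * m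
          a-a≡0*m = solve-∀

  mod-reflexive : ∀ {a b} → a ≡ b → a ≈ b [mod m ]
  mod-reflexive refl = mod-refl

  mod-sym : ∀ {a b} → a ≈ b [mod m ] → b ≈ a [mod m ]
  mod-sym {a} {b} a≈b =
    fromSigned (subst (m Signed.∣_) (neg-minus a b) (Signed.∣m⇒∣-m (toSigned a≈b)))
    where neg-minus : ∀ a b → - (a - b) ≡ b - a
          neg-minus = solve-∀

  mod-trans : ∀ {a b c} → a ≈ b [mod m ] → b ≈ c [mod m ] → a ≈ c [mod m ]
  mod-trans {a} {b} {c} a≈b b≈c = fromSigned (subst (m Signed.∣_) (telescope a b c)
    (Signed.∣m∣n⇒∣m+n (toSigned a≈b) (toSigned b≈c)))
    where telescope : ∀ a b c → (a - b) + (b - c) ≡ a - c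
          telescope = solve-∀

  +-cong-mod : ∀ {a b c d} → a ≈ b [mod m ] → c ≈ d [mod m ] → a + c ≈ b + d [mod m ]
  +-cong-mod {a} {b} {c} {d} a≈b c≈d = fromSigned (subst (m Signed.∣_) (interchange a b c d)
    (Signed.∣m∣n⇒∣m+n (toSigned a≈b) (toSigned c≈d)))
    where interchange : ∀ a b c d → (a - b) + (c - d) ≡ (a + c) - (b + d)
          interchange = solve-∀

  *-cong-mod : ∀ {a b c d} → a ≈ b [mod m ] → c ≈ d [mod m ] → a * c ≈ b * d [mod m ]
  *-cong-mod {a} {b} {c} {d} a≈b c≈d = fromSigned (subst (m Signed.∣_) (split a b c d)
    (Signed.∣m∣n⇒∣m+n (Signed.∣n⇒∣m*n c (toSigned a≈b)) (Signed.∣n⇒∣m*n b (toSigned c≈d))))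
    where split : ∀ a b c d → c * (a - b) + b * (c - d) ≡ a * c - b * d
          split = solve-∀

  *-congˡ-mod : ∀ c {a b} → a ≈ b [mod m ] → c * a ≈ c * b [mod m ]
  *-congˡ-mod c = *-cong-mod (mod-refl {c})

  mod-setoid : Setoid _ _
  mod-setoid = record
    { Carrier = ℤ
    ; _≈_ = _≈_[mod m ]
    ; isEquivalence = record { refl = mod-refl ; sym = mod-sym ; trans = mod-trans }
    }

module ≈-mod-Reasoning (m : ℤ) = Relation.Binary.Reasoning.Setoid (mod-setoid {m})

mod-weaken : ∀ {m n a b} → n Signed.∣ m → a ≈ b [mod m ] → a ≈ b [mod n ]
mod-weaken {a = a} {b} n∣m (mk≈ d) = mk≈ (∣⇒∣ᵤ {i = a - b} (Signed.∣-trans n∣m (∣ᵤ⇒∣ d)))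

+-multiple-mod : ∀ {m} a q → a + q * m ≈ a [mod m ]
+-multiple-mod {m} a q = ≡⇒≈-mod q (cancel a q m)
  where cancel : ∀ a q m → a + q * m - a ≡ q * m
        cancel = solve-∀

^-cong-mod : ∀ {m x y} n → x ≈ y [mod m ] → x ^ n ≈ y ^ n [mod m ]
^-cong-mod zero    x≈y = mod-refl
^-cong-mod (suc n) x≈y = *-cong-mod x≈y (^-cong-mod n x≈y)

^-distribʳ-* : ∀ x y n → (x * y) ^ n ≡ x ^ n * y ^ n
^-distribʳ-* x y zero    = refl
^-distribʳ-* x y (suc n) = trans (cong ((x * y) *_) (^-distribʳ-* x y n)) (interchange x y (x ^ n) (y ^ n))
  where interchange : ∀ x y u v → x * y * (u * v) ≡ x * u * (y * v)
        interchange = solve-∀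

power-law : ∀ {m F} (T : ℤ → ℤ) → T 0ℤ ≡ F → (∀ u v → T u * T v ≈ F * T (u + v) [mod m ]) →
  ∀ n → F * T 1ℤ ^ n ≈ F ^ n * T (+ n) [mod m ]
power-law {m} {F} T T0≡F TT≈FT zero =
  mod-reflexive (trans (ℤ.*-identityʳ F) (trans (sym T0≡F) (sym (ℤ.*-identityˡ (T 0ℤ)))))
power-law {m} {F} T T0≡F TT≈FT (suc n) = begin
  F * (T 1ℤ * T 1ℤ ^ n)      ≡⟨ swap F (T 1ℤ) (T 1ℤ ^ n) ⟩
  T 1ℤ * (F * T 1ℤ ^ n)      ≈⟨ *-congˡ-mod (T 1ℤ) (power-law T T0≡F TT≈FT n) ⟩
  T 1ℤ * (F ^ n * T (+ n))   ≡⟨ swap (T 1ℤ) (F ^ n) (T (+ n)) ⟩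
  F ^ n * (T 1ℤ * T (+ n))   ≡⟨ cong (F ^ n *_) (ℤ.*-comm (T 1ℤ) (T (+ n))) ⟩
  F ^ n * (T (+ n) * T 1ℤ)   ≈⟨ *-congˡ-mod (F ^ n) (TT≈FT (+ n) 1ℤ) ⟩
  F ^ n * (F * T (+ n + 1ℤ)) ≡⟨ cong (λ t → F ^ n * (F * T t)) (cong +_ (ℕ.+-comm n 1)) ⟩
  F ^ n * (F * T (+ suc n))  ≡⟨ swap (F ^ n) F (T (+ suc n)) ⟩
  F * (F ^ n * T (+ suc n))  ≡⟨ ℤ.*-assoc F (F ^ n) (T (+ suc n)) ⟨
  F * F ^ n * T (+ suc n)    ∎
  where
  open ≈-mod-Reasoning m
  swap : ∀ x y z → x * (y * z) ≡ y * (x * z)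
  swap = solve-∀

-- Primes

prime∤* : ∀ {p a b} → Prime p → ¬ p ℕ.∣ a → ¬ p ℕ.∣ b → ¬ p ℕ.∣ a ℕ.* b
prime∤* {a = a} {b} pr p∤a p∤b p∣ab with euclidsLemma a b pr p∣ab
... | inj₁ p∣a = p∤a p∣a
... | inj₂ p∣b = p∤b p∣b

prime∤-< : ∀ {p j} → 0 ℕ.< j → j ℕ.< p → ¬ p ℕ.∣ j
prime∤-< {j = suc j} _ j<p p∣j = ℕ.<⇒≱ j<p (ℕ.∣⇒≤ p∣j)

prime^∣-cancelˡ : ∀ {p c w} n → Prime p → ¬ p ℕ.∣ c → p ℕ.^ n ℕ.∣ c ℕ.* w → p ℕ.^ n ℕ.∣ w
prime^∣-cancelˡ zero _ _ _ = ℕ.1∣ _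
prime^∣-cancelˡ {p} {c} {w} (suc n) pr p∤c pⁿ⁺¹∣cw
  with euclidsLemma c w pr (ℕ.m*n∣⇒m∣ p (p ℕ.^ n) pⁿ⁺¹∣cw)
... | inj₁ p∣c = contradiction p∣c p∤c
... | inj₂ (ℕ.divides q refl) = subst (p ℕ.^ suc n ℕ.∣_) (ℕ.*-comm p q) (ℕ.*-monoʳ-∣ p pⁿ∣q)
  where
  instance _ = prime⇒nonZero pr
  pⁿ∣q : p ℕ.^ n ℕ.∣ q
  pⁿ∣q = prime^∣-cancelˡ n pr p∤c (ℕ.*-cancelˡ-∣ p (subst (p ℕ.* p ℕ.^ n ℕ.∣_) c[qp]≡p[cq] pⁿ⁺¹∣cw))
    where c[qp]≡p[cq] : c ℕ.* (q ℕ.* p) ≡ p ℕ.* (c ℕ.* q)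
          c[qp]≡p[cq] = trans (sym (ℕ.*-assoc c q p)) (ℕ.*-comm (c ℕ.* q) p)

prime∤1 : ∀ {p} → Prime p → ¬ p ℕ.∣ 1
prime∤1 pr p∣1 = ℕ.<⇒≱ (ℕ.nonTrivial⇒n>1 _ {{prime⇒nonTrivial pr}}) (ℕ.∣⇒≤ p∣1)

prime∤^ : ∀ {p c} n → Prime p → ¬ p ℕ.∣ c → ¬ p ℕ.∣ c ℕ.^ n
prime∤^ zero    pr p∤c = prime∤1 pr
prime∤^ (suc n) pr p∤c = prime∤* pr p∤c (prime∤^ n pr p∤c)

prime∤! : ∀ {p} n → Prime p → n ℕ.< p → ¬ p ℕ.∣ n !
prime∤! zero    pr _   = prime∤1 pr
prime∤! (suc n) pr n<p = prime∤* pr (prime∤-< (ℕ.s≤s ℕ.z≤n) n<p) (prime∤! n pr (ℕ.<-trans (ℕ.n<1+n n) n<p))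

∣i^n∣≡∣i∣^n : ∀ i n → ∣ i ^ n ∣ ≡ ∣ i ∣ ℕ.^ n
∣i^n∣≡∣i∣^n i zero = refl
∣i^n∣≡∣i∣^n i (suc n) = trans (ℤ.abs-* i (i ^ n)) (cong (∣ i ∣ ℕ.*_) (∣i^n∣≡∣i∣^n i n))

*-cancelˡ-mod-prime^ : ∀ {p c x y} n → Prime p → ¬ (+ p ∣ c) →
  c * x ≈ c * y [mod (+ p) ^ n ] → x ≈ y [mod (+ p) ^ n ]
*-cancelˡ-mod-prime^ {p} {c} {x} {y} n pr p∤c (mk≈ pⁿ∣cx-cy) =
  mk≈ (subst (ℕ._∣ ∣ x - y ∣) (sym (∣i^n∣≡∣i∣^n (+ p) n))
        (prime^∣-cancelˡ n pr p∤c (subst₂ ℕ._∣_ (∣i^n∣≡∣i∣^n (+ p) n) ∣cx-cy∣≡∣c∣*∣x-y∣ pⁿ∣cx-cy)))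
  where
  factor : ∀ c x y → c * x - c * y ≡ c * (x - y)
  factor = solve-∀
  ∣cx-cy∣≡∣c∣*∣x-y∣ : ∣ c * x - c * y ∣ ≡ ∣ c ∣ ℕ.* ∣ x - y ∣
  ∣cx-cy∣≡∣c∣*∣x-y∣ = trans (cong ∣_∣ (factor c x y)) (ℤ.abs-* c (x - y))

*-cancelˡ-mod-prime : ∀ {p c x y} → Prime p → ¬ (+ p ∣ c) →
  c * x ≈ c * y [mod + p ] → x ≈ y [mod + p ]
*-cancelˡ-mod-prime {p} {c} pr p∤c cx≈cy =
  mod-weaken p∣p¹ (*-cancelˡ-mod-prime^ {c = c} 1 pr p∤c (mod-weaken p¹∣p cx≈cy))
  where
  p∣p¹ : + p Signed.∣ (+ p) ^ 1
  p∣p¹ = Signed.∣m⇒∣m*n 1ℤ Signed.∣-refl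
  p¹∣p : (+ p) ^ 1 Signed.∣ + p
  p¹∣p = Signed.∣-reflexive (ℤ.*-identityʳ (+ p))

mod-∤ : ∀ {p x y} → x ≈ y [mod + p ] → ¬ (+ p ∣ y) → ¬ (+ p ∣ x)
mod-∤ {p} {x} {y} (mk≈ p∣x-y) p∤y p∣x = p∤y (∣⇒∣ᵤ (subst (+ p Signed.∣_) (cancel x y)
  (Signed.∣m∣n⇒∣m-n (∣ᵤ⇒∣ {i = x} p∣x) (∣ᵤ⇒∣ p∣x-y))))
  where cancel : ∀ x y → x - (x - y) ≡ y
        cancel = solve-∀

module _ {p} (pr : Prime p) where

  prime∤*ℤ : ∀ x y → ¬ (+ p ∣ x) → ¬ (+ p ∣ y) → ¬ (+ p ∣ x * y)
  prime∤*ℤ x y p∤x p∤y p∣xy = prime∤* pr p∤x p∤y (subst (p ℕ.∣_) (ℤ.abs-* x y) p∣xy)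

  prime∤^ℤ : ∀ x n → ¬ (+ p ∣ x) → ¬ (+ p ∣ x ^ n)
  prime∤^ℤ x n p∤x p∣xⁿ = prime∤^ n pr p∤x (subst (p ℕ.∣_) (∣i^n∣≡∣i∣^n x n) p∣xⁿ)

  prime∣*ℤ⇒∣ : ∀ c x → ¬ (+ p ∣ c) → + p ∣ c * x → + p ∣ x
  prime∣*ℤ⇒∣ c x p∤c p∣cx with euclidsLemma ∣ c ∣ ∣ x ∣ pr (subst (p ℕ.∣_) (ℤ.abs-* c x) p∣cx)
  ... | inj₁ p∣c = contradiction p∣c p∤c
  ... | inj₂ p∣x = p∣x

n*2≡n+n : ∀ n → n ℕ.* 2 ≡ n ℕ.+ n
n*2≡n+n = ℕ-Solver.solve-∀

prime>2⇒odd : ∀ {p} → Prime p → 2 ℕ.< p → ∃[ h ] p ≡ suc (h ℕ.+ h)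
prime>2⇒odd {p} pr 2<p with p % 2 | m≡m%n+[m/n]*n p 2 | m%n<n p 2
... | 0 | p≡[p/2]*2 | _ with prime⇒irreducible pr (ℕ.divides (p / 2) p≡[p/2]*2)
...   | inj₁ ()
...   | inj₂ 2≡p = contradiction 2≡p (ℕ.<⇒≢ 2<p)
prime>2⇒odd {p} pr 2<p | 1 | p≡1+[p/2]*2 | _ = p / 2 , trans p≡1+[p/2]*2 (cong suc (n*2≡n+n (p / 2)))
prime>2⇒odd {p} pr 2<p | suc (suc _) | _ | ℕ.s≤s (ℕ.s≤s ())

-- The top elementary symmetric functions

eₙ eₙ₋₁ eₙ₋₂ : List ℤ → ℤ
eₙ []       = 1ℤ
eₙ (x ∷ xs) = x * eₙ xs
eₙ₋₁ []       = 0ℤ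
eₙ₋₁ (x ∷ xs) = x * eₙ₋₁ xs + eₙ xs
eₙ₋₂ []       = 0ℤ
eₙ₋₂ (x ∷ xs) = x * eₙ₋₂ xs + eₙ₋₁ xs

eₙ-++ : ∀ xs ys → eₙ (xs ++ ys) ≡ eₙ xs * eₙ ys
eₙ-++ []       ys = sym (ℤ.*-identityˡ (eₙ ys))
eₙ-++ (x ∷ xs) ys = trans (cong (x *_) (eₙ-++ xs ys)) (sym (ℤ.*-assoc x (eₙ xs) (eₙ ys)))

eₙ₋₁-++ : ∀ xs ys → eₙ₋₁ (xs ++ ys) ≡ eₙ₋₁ xs * eₙ ys + eₙ xs * eₙ₋₁ ys
eₙ₋₁-++ []       ys = identity (eₙ ys) (eₙ₋₁ ys)
  where identity : ∀ e d → d ≡ 0ℤ * e + 1ℤ * d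
        identity = solve-∀
eₙ₋₁-++ (x ∷ xs) ys rewrite eₙ₋₁-++ xs ys | eₙ-++ xs ys = step x (eₙ xs) (eₙ₋₁ xs) (eₙ ys) (eₙ₋₁ ys)
  where step : ∀ x e d f g → x * (d * f + e * g) + e * f ≡ (x * d + e) * f + x * e * g
        step = solve-∀

eₙ-↭ : ∀ {xs ys} → xs ↭ ys → eₙ xs ≡ eₙ ys
eₙ-↭ ↭.refl          = refl
eₙ-↭ (↭.prep x p)    = cong (x *_) (eₙ-↭ p)
eₙ-↭ (↭.swap x y p)  = trans (cong (λ e → x * (y * e)) (eₙ-↭ p)) (swap x y _)
  where swap : ∀ x y e → x * (y * e) ≡ y * (x * e)
        swap = solve-∀
eₙ-↭ (↭.trans p q)   = trans (eₙ-↭ p) (eₙ-↭ q)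

eₙ₋₁-↭ : ∀ {xs ys} → xs ↭ ys → eₙ₋₁ xs ≡ eₙ₋₁ ys
eₙ₋₁-↭ ↭.refl = refl
eₙ₋₁-↭ (↭.prep x p) rewrite eₙ₋₁-↭ p | eₙ-↭ p = refl
eₙ₋₁-↭ (↭.swap x y p) rewrite eₙ₋₁-↭ p | eₙ-↭ p = swap x y _ _
  where swap : ∀ x y d e → x * (y * d + e) + y * e ≡ y * (x * d + e) + x * e
        swap = solve-∀
eₙ₋₁-↭ (↭.trans p q) = trans (eₙ₋₁-↭ p) (eₙ₋₁-↭ q)

module _ {m : ℤ} where

  eₙ-cong-mod : ∀ {xs ys} → Pointwise _≈_[mod m ] xs ys → eₙ xs ≈ eₙ ys [mod m ]
  eₙ-cong-mod Pointwise.[]              = mod-refl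
  eₙ-cong-mod (x≈y Pointwise.∷ xs≈ys) = *-cong-mod x≈y (eₙ-cong-mod xs≈ys)

  eₙ₋₁-cong-mod : ∀ {xs ys} → Pointwise _≈_[mod m ] xs ys → eₙ₋₁ xs ≈ eₙ₋₁ ys [mod m ]
  eₙ₋₁-cong-mod Pointwise.[]              = mod-refl
  eₙ₋₁-cong-mod (x≈y Pointwise.∷ xs≈ys) =
    +-cong-mod (*-cong-mod x≈y (eₙ₋₁-cong-mod xs≈ys)) (eₙ-cong-mod xs≈ys)

eₙ-map-* : ∀ c xs → eₙ (map (c *_) xs) ≡ c ^ length xs * eₙ xs
eₙ-map-* c []       = refl
eₙ-map-* c (x ∷ xs) rewrite eₙ-map-* c xs = step c x (c ^ length xs) (eₙ xs)
  where step : ∀ c x u e → c * x * (u * e) ≡ c * u * (x * e)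
        step = solve-∀

eₙ₋₁-map-* : ∀ c xs → c * eₙ₋₁ (map (c *_) xs) ≡ c ^ length xs * eₙ₋₁ xs
eₙ₋₁-map-* c []       = ℤ.*-zeroʳ c
eₙ₋₁-map-* c (x ∷ xs) = begin
  c * (c * x * eₙ₋₁ (map (c *_) xs) + eₙ (map (c *_) xs))
    ≡⟨ regroup c x (eₙ₋₁ (map (c *_) xs)) (eₙ (map (c *_) xs)) ⟩
  c * x * (c * eₙ₋₁ (map (c *_) xs)) + c * eₙ (map (c *_) xs)
    ≡⟨ cong₂ (λ d e → c * x * d + c * e) (eₙ₋₁-map-* c xs) (eₙ-map-* c xs) ⟩
  c * x * (c ^ length xs * eₙ₋₁ xs) + c * (c ^ length xs * eₙ xs)
    ≡⟨ factor c x (c ^ length xs) (eₙ₋₁ xs) (eₙ xs) ⟩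
  c * c ^ length xs * (x * eₙ₋₁ xs + eₙ xs) ∎
  where open ≡-Reasoning
        regroup : ∀ c x d e → c * (c * x * d + e) ≡ c * x * (c * d) + c * e
        regroup = solve-∀
        factor : ∀ c x u d e → c * x * (u * d) + c * (u * e) ≡ c * u * (x * d + e)
        factor = solve-∀

eₙ₋₂-map-* : ∀ c xs → c * c * eₙ₋₂ (map (c *_) xs) ≡ c ^ length xs * eₙ₋₂ xs
eₙ₋₂-map-* c []       = ℤ.*-zeroʳ (c * c)
eₙ₋₂-map-* c (x ∷ xs) = begin
  c * c * (c * x * eₙ₋₂ (map (c *_) xs) + eₙ₋₁ (map (c *_) xs))
    ≡⟨ regroup c x (eₙ₋₂ (map (c *_) xs)) (eₙ₋₁ (map (c *_) xs)) ⟩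
  c * x * (c * c * eₙ₋₂ (map (c *_) xs)) + c * (c * eₙ₋₁ (map (c *_) xs))
    ≡⟨ cong₂ (λ f d → c * x * f + c * d) (eₙ₋₂-map-* c xs) (eₙ₋₁-map-* c xs) ⟩
  c * x * (c ^ length xs * eₙ₋₂ xs) + c * (c ^ length xs * eₙ₋₁ xs)
    ≡⟨ factor c x (c ^ length xs) (eₙ₋₂ xs) (eₙ₋₁ xs) ⟩
  c * c ^ length xs * (x * eₙ₋₂ xs + eₙ₋₁ xs) ∎
  where open ≡-Reasoning
        regroup : ∀ c x f d → c * c * (c * x * f + d) ≡ c * x * (c * c * f) + c * (c * d)
        regroup = solve-∀
        factor : ∀ c x u f d → c * x * (u * f) + c * (u * d) ≡ c * u * (x * f + d)
        factor = solve-∀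

eₙ-map-neg : ∀ x xs → eₙ (map (_- x) xs) ≡ (- 1ℤ) ^ length xs * eₙ (map (λ j → x - j) xs)
eₙ-map-neg x []       = refl
eₙ-map-neg x (j ∷ xs) rewrite eₙ-map-neg x xs = flip x j ((- 1ℤ) ^ length xs) (eₙ (map (λ j → x - j) xs))
  where flip : ∀ x j s e → (j - x) * (s * e) ≡ - 1ℤ * s * ((x - j) * e)
        flip = solve-∀

eₙ-shift≈ : ∀ x xs → eₙ (map (_- x) xs) ≈ eₙ xs - eₙ₋₁ xs * x + eₙ₋₂ xs * (x * x) [mod x ^ 3 ]
eₙ-shift≈ x []       = mod-reflexive (constant x)
  where constant : ∀ x → 1ℤ ≡ 1ℤ - 0ℤ * x + 0ℤ * (x * x)
        constant = solve-∀
eₙ-shift≈ x (j ∷ xs) = begin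
  (j - x) * eₙ (map (_- x) xs)
    ≈⟨ *-congˡ-mod (j - x) (eₙ-shift≈ x xs) ⟩
  (j - x) * (e - d * x + f * (x * x))
    ≡⟨ expand j x e d f ⟩
  j * e - (j * d + e) * x + (j * f + d) * (x * x) + (- f) * x ^ 3
    ≈⟨ +-multiple-mod _ (- f) ⟩
  j * e - (j * d + e) * x + (j * f + d) * (x * x) ∎
  where
  open ≈-mod-Reasoning (x ^ 3)
  e d f : ℤ
  e = eₙ xs
  d = eₙ₋₁ xs
  f = eₙ₋₂ xs
  expand : ∀ j x e d f → (j - x) * (e - d * x + f * (x * x))
    ≡ j * e - (j * d + e) * x + (j * f + d) * (x * x) + (- f) * (x * (x * (x * 1ℤ)))
  expand = solve-∀

squares : List ℤ → List ℤ
squares = map (λ x → x * x)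

eₙ-squares : ∀ xs → eₙ (squares xs) ≡ eₙ xs * eₙ xs
eₙ-squares []       = refl
eₙ-squares (x ∷ xs) rewrite eₙ-squares xs = interchange x (eₙ xs)
  where interchange : ∀ x e → x * x * (e * e) ≡ x * e * (x * e)
        interchange = solve-∀

eₙ₋₁-squares : ∀ xs → eₙ₋₁ xs * eₙ₋₁ xs - + 2 * eₙ xs * eₙ₋₂ xs ≡ eₙ₋₁ (squares xs)
eₙ₋₁-squares []       = refl
eₙ₋₁-squares (x ∷ xs) = begin
  (x * d + e) * (x * d + e) - + 2 * (x * e) * (x * f + d)
    ≡⟨ expand x e d f ⟩
  x * x * (d * d - + 2 * e * f) + e * e
    ≡⟨ cong₂ (λ s t → x * x * s + t) (eₙ₋₁-squares xs) (sym (eₙ-squares xs)) ⟩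
  x * x * eₙ₋₁ (squares xs) + eₙ (squares xs) ∎
  where
  open ≡-Reasoning
  e d f : ℤ
  e = eₙ xs
  d = eₙ₋₁ xs
  f = eₙ₋₂ xs
  expand : ∀ x e d f → (x * d + e) * (x * d + e) - + 2 * (x * e) * (x * f + d)
    ≡ x * x * (d * d - + 2 * e * f) + e * e
  expand = solve-∀

eₙ-doubled : ∀ xs → eₙ (squares xs ++ squares xs) ≡ eₙ xs * eₙ xs * (eₙ xs * eₙ xs)
eₙ-doubled xs = trans (eₙ-++ (squares xs) (squares xs)) (cong₂ _*_ (eₙ-squares xs) (eₙ-squares xs))

eₙ₋₁-doubled : ∀ xs → eₙ₋₁ (squares xs ++ squares xs) ≡ + 2 * (eₙ xs * eₙ xs) * eₙ₋₁ (squares xs)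
eₙ₋₁-doubled xs = begin
  eₙ₋₁ (squares xs ++ squares xs)
    ≡⟨ eₙ₋₁-++ (squares xs) (squares xs) ⟩
  eₙ₋₁ (squares xs) * eₙ (squares xs) + eₙ (squares xs) * eₙ₋₁ (squares xs)
    ≡⟨ cong (λ e → eₙ₋₁ (squares xs) * e + e * eₙ₋₁ (squares xs)) (eₙ-squares xs) ⟩
  eₙ₋₁ (squares xs) * (eₙ xs * eₙ xs) + eₙ xs * eₙ xs * eₙ₋₁ (squares xs)
    ≡⟨ twice (eₙ₋₁ (squares xs)) (eₙ xs * eₙ xs) ⟩
  + 2 * (eₙ xs * eₙ xs) * eₙ₋₁ (squares xs) ∎
  where
  open ≡-Reasoning
  twice : ∀ d s → d * s + s * d ≡ + 2 * s * d
  twice = solve-∀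

squares-reflect≈ : ∀ m xs → Pointwise _≈_[mod m ] (squares (map (λ x → m - x) xs)) (squares xs)
squares-reflect≈ m []       = Pointwise.[]
squares-reflect≈ m (x ∷ xs) = ≡⇒≈-mod (m - x - x) (reflect m x) Pointwise.∷ squares-reflect≈ m xs
  where reflect : ∀ m x → (m - x) * (m - x) - x * x ≡ (m - x - x) * m
        reflect = solve-∀

-- Lists of consecutive integers

module _ {A : Set} where

  applyUpTo-cong : ∀ {f g : ℕ → A} n → (∀ {i} → i ℕ.< n → f i ≡ g i) →
    applyUpTo f n ≡ applyUpTo g n
  applyUpTo-cong zero    f≗g = refl
  applyUpTo-cong (suc n) f≗g =
    cong₂ _∷_ (f≗g (ℕ.s≤s ℕ.z≤n)) (applyUpTo-cong n (λ i<n → f≗g (ℕ.s≤s i<n)))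

  applyUpTo-++ : ∀ (f : ℕ → A) m n →
    applyUpTo f (m ℕ.+ n) ≡ applyUpTo f m ++ applyUpTo (λ i → f (m ℕ.+ i)) n
  applyUpTo-++ f zero    n = refl
  applyUpTo-++ f (suc m) n = cong (f 0 ∷_) (applyUpTo-++ (f ∘ suc) m n)

  applyDownFrom≡applyUpTo : ∀ (f : ℕ → A) n →
    applyDownFrom f n ≡ applyUpTo (λ i → f (n ∸ suc i)) n
  applyDownFrom≡applyUpTo f zero    = refl
  applyDownFrom≡applyUpTo f (suc n) = cong (f n ∷_) (applyDownFrom≡applyUpTo f n)

  applyUpTo-reverse-↭ : ∀ (f : ℕ → A) n → applyUpTo (λ i → f (n ∸ suc i)) n ↭ applyUpTo f n
  applyUpTo-reverse-↭ f n = subst (_↭ applyUpTo f n)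
    (trans (reverse-applyUpTo f n) (applyDownFrom≡applyUpTo f n)) (↭-reverse (applyUpTo f n))

  applyUpTo-interleave-↭ : ∀ (f : ℕ → A) n →
    applyUpTo f (n ℕ.+ n) ↭ applyUpTo (λ i → f (i ℕ.+ i)) n ++ applyUpTo (λ i → f (suc (i ℕ.+ i))) n
  applyUpTo-interleave-↭ f zero    = ↭.refl
  applyUpTo-interleave-↭ f (suc n) = begin
    f 0 ∷ applyUpTo (f ∘ suc) (n ℕ.+ suc n)
      ≡⟨ cong (λ k → f 0 ∷ applyUpTo (f ∘ suc) k) (ℕ.+-suc n n) ⟩
    f 0 ∷ f 1 ∷ applyUpTo (f ∘ suc ∘ suc) (n ℕ.+ n)
      ↭⟨ ↭.prep (f 0) (↭.prep (f 1) (applyUpTo-interleave-↭ (f ∘ suc ∘ suc) n)) ⟩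
    f 0 ∷ f 1 ∷ evens ++ odds
      ↭⟨ ↭.prep (f 0) (↭.↭-sym (shift (f 1) evens odds)) ⟩
    f 0 ∷ evens ++ f 1 ∷ odds
      ≡⟨ cong₂ (λ es os → f 0 ∷ es ++ f 1 ∷ os) (evens≡ (λ i → f i)) (evens≡ (λ i → f (suc i))) ⟩
    applyUpTo (λ i → f (i ℕ.+ i)) (suc n) ++ applyUpTo (λ i → f (suc (i ℕ.+ i))) (suc n) ∎
    where
    open ↭.PermutationReasoning
    evens odds : List A
    evens = applyUpTo (λ i → f (suc (suc (i ℕ.+ i)))) n
    odds  = applyUpTo (λ i → f (suc (suc (suc (i ℕ.+ i))))) n
    evens≡ : ∀ g → applyUpTo (λ i → g (suc (suc (i ℕ.+ i)))) n ≡ applyUpTo (λ i → g (suc (i ℕ.+ suc i))) n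
    evens≡ g = applyUpTo-cong n (λ {i} _ → cong (λ k → g (suc k)) (sym (ℕ.+-suc i i)))

applyUpTo-reflect-↭ : ∀ c (f g : ℕ → ℤ) n → (∀ {i} → i ℕ.< n → g (n ∸ suc i) ≡ c - f i) →
  applyUpTo g n ↭ map (λ x → c - x) (applyUpTo f n)
applyUpTo-reflect-↭ c f g n g≡c-f = begin
  applyUpTo g n                      ↭⟨ ↭.↭-sym (applyUpTo-reverse-↭ g n) ⟩
  applyUpTo (λ i → g (n ∸ suc i)) n  ≡⟨ applyUpTo-cong n g≡c-f ⟩
  applyUpTo (λ i → c - f i) n        ≡⟨ sym (map-applyUpTo f (λ x → c - x) n) ⟩
  map (λ x → c - x) (applyUpTo f n)  ∎
  where open ↭.PermutationReasoning

pos-≡-minus : ∀ {a b c} → a ℕ.+ c ≡ b → + a ≡ + b - + c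
pos-≡-minus {a} {c = c} refl = trans (add-sub (+ a) (+ c)) (cong (_- + c) (sym (ℤ.pos-+ a c)))
  where add-sub : ∀ x y → x ≡ x + y - y
        add-sub = solve-∀

oneTo : ℕ → List ℤ
oneTo n = applyUpTo (λ i → + suc i) n

eₙ-applyUpTo-suc : ∀ f n → eₙ (applyUpTo f (suc n)) ≡ eₙ (applyUpTo f n) * f n
eₙ-applyUpTo-suc f n = begin
  eₙ (applyUpTo f (suc n))         ≡⟨ cong eₙ (sym (applyUpTo-∷ʳ f n)) ⟩
  eₙ (applyUpTo f n ++ [ f n ])    ≡⟨ eₙ-++ (applyUpTo f n) [ f n ] ⟩
  eₙ (applyUpTo f n) * (f n * 1ℤ)  ≡⟨ cong (eₙ (applyUpTo f n) *_) (ℤ.*-identityʳ (f n)) ⟩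
  eₙ (applyUpTo f n) * f n         ∎
  where open ≡-Reasoning

eₙ-oneTo : ∀ n → eₙ (oneTo n) ≡ + (n !)
eₙ-oneTo zero    = refl
eₙ-oneTo (suc n) = begin
  eₙ (oneTo (suc n))      ≡⟨ eₙ-applyUpTo-suc (λ i → + suc i) n ⟩
  eₙ (oneTo n) * + suc n  ≡⟨ cong (_* + suc n) (eₙ-oneTo n) ⟩
  + (n !) * + suc n       ≡⟨ ℤ.*-comm (+ (n !)) (+ suc n) ⟩
  + suc n * + (n !)       ≡⟨ ℤ.pos-* (suc n) (n !) ⟨
  + (suc n !)             ∎
  where open ≡-Reasoning

eₙ-fallingFactorial : ∀ n k → eₙ (applyUpTo (λ i → + (n ∸ i)) k) ≡ + (n P′ k)
eₙ-fallingFactorial n zero    = refl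
eₙ-fallingFactorial n (suc k) = begin
  eₙ (applyUpTo (λ i → + (n ∸ i)) (suc k))        ≡⟨ eₙ-applyUpTo-suc (λ i → + (n ∸ i)) k ⟩
  eₙ (applyUpTo (λ i → + (n ∸ i)) k) * + (n ∸ k)  ≡⟨ cong (_* + (n ∸ k)) (eₙ-fallingFactorial n k) ⟩
  + (n P′ k) * + (n ∸ k)                          ≡⟨ ℤ.*-comm (+ (n P′ k)) (+ (n ∸ k)) ⟩
  + (n ∸ k) * + (n P′ k)                          ≡⟨ ℤ.pos-* (n ∸ k) (n P′ k) ⟨
  + (n P′ suc k)                                  ∎
  where open ≡-Reasoning

nCk*k!≡nP′k : ∀ {n k} → k ℕ.≤ n → (n C k) ℕ.* k ! ≡ n P′ k
nCk*k!≡nP′k {n} {k} k≤n = begin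
  (n C k) ℕ.* k !                        ≡⟨ cong (ℕ._* k !) (nCk≡nPk/k! k≤n) ⟩
  ((n Combinatorics.P k) / k !) ℕ.* k !  ≡⟨ cong (λ x → (x / k !) ℕ.* k !) P≡P′ ⟩
  ((n P′ k) / k !) ℕ.* k !               ≡⟨ m/n*n≡m (k!∣nP′k k≤n) ⟩
  n P′ k                                 ∎
  where
  open ≡-Reasoning
  instance _ = k ℕ.!≢0
  P≡P′ : n Combinatorics.P k ≡ n P′ k
  P≡P′ = trans (nPk≡n!/[n∸k]! k≤n) (sym (nP′k≡n!/[n∸k]! k≤n))

eₙ-reflect-oneTo : ∀ {n k} → k ℕ.≤ n → eₙ (map (λ j → + suc n - j) (oneTo k)) ≡ + (n C k) * + (k !)
eₙ-reflect-oneTo {n} {k} k≤n = begin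
  eₙ (map (λ j → + suc n - j) (oneTo k))
    ≡⟨ cong eₙ (map-applyUpTo (λ i → + suc i) _ k) ⟩
  eₙ (applyUpTo (λ i → + suc n - + suc i) k)
    ≡⟨ cong eₙ (applyUpTo-cong k (λ i<k → sym (pos-≡-minus (n∸i+1+i i<k)))) ⟩
  eₙ (applyUpTo (λ i → + (n ∸ i)) k)  ≡⟨ eₙ-fallingFactorial n k ⟩
  + (n P′ k)                          ≡⟨ cong +_ (nCk*k!≡nP′k k≤n) ⟨
  + ((n C k) ℕ.* k !)                 ≡⟨ ℤ.pos-* (n C k) (k !) ⟩
  + (n C k) * + (k !)                 ∎
  where
  open ≡-Reasoning
  n∸i+1+i : ∀ {i} → i ℕ.< k → n ∸ i ℕ.+ suc i ≡ suc n
  n∸i+1+i {i} i<k = trans (ℕ.+-suc (n ∸ i) i) (cong suc (ℕ.m∸n+n≡m (ℕ.≤-trans (ℕ.<⇒≤ i<k) k≤n)))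

-- The quadratic approximation

module QuadraticApproximation (m : ℤ) (xs : List ℤ) where

  a b c : ℤ
  a = eₙ xs
  b = eₙ₋₁ xs
  c = eₙ₋₂ xs

  -- 4 ∏ (x − tm/2) over x in xs, truncated after the quadratic term in m.
  T : ℤ → ℤ
  T t = + 4 * a - + 2 * t * (b * m) + t * t * (c * (m * m))

  T-mul : m Signed.∣ (b * b - + 2 * a * c) → ∀ u v → T u * T v ≈ + 4 * a * T (u + v) [mod m ^ 3 ]
  T-mul (divides δ b²-2ac≡δm) u v = ≡⇒≈-mod (+ 4 * u * v * δ + u * v * r) (begin
    T u * T v - + 4 * a * T (u + v)
      ≡⟨ expand a b c m u v ⟩
    + 4 * u * v * (m * m) * (b * b - + 2 * a * c) + u * v * r * m ^ 3
      ≡⟨ cong (λ e → + 4 * u * v * (m * m) * e + u * v * r * m ^ 3) b²-2ac≡δm ⟩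
    + 4 * u * v * (m * m) * (δ * m) + u * v * r * m ^ 3
      ≡⟨ collect δ m u v r ⟩
    (+ 4 * u * v * δ + u * v * r) * m ^ 3 ∎)
    where
    open ≡-Reasoning
    r : ℤ
    r = u * v * (c * c * m) - + 2 * (u + v) * (b * c)
    expand : ∀ a b c m u v →
      (+ 4 * a - + 2 * u * (b * m) + u * u * (c * (m * m))) * (+ 4 * a - + 2 * v * (b * m) + v * v * (c * (m * m)))
        - + 4 * a * (+ 4 * a - + 2 * (u + v) * (b * m) + (u + v) * (u + v) * (c * (m * m)))
      ≡ + 4 * u * v * (m * m) * (b * b - + 2 * a * c)
        + u * v * (u * v * (c * c * m) - + 2 * (u + v) * (b * c)) * (m * (m * (m * 1ℤ)))
    expand = solve-∀
    collect : ∀ δ m u v r →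
      + 4 * u * v * (m * m) * (δ * m) + u * v * r * (m * (m * (m * 1ℤ)))
      ≡ (+ 4 * u * v * δ + u * v * r) * (m * (m * (m * 1ℤ)))
    collect = solve-∀

  eₙ-shift≈T : ∀ t → + 4 * eₙ (map (_- t * m) xs) ≈ T (+ 2 * t) [mod m ^ 3 ]
  eₙ-shift≈T t = begin
    + 4 * eₙ (map (_- t * m) xs)
      ≈⟨ *-congˡ-mod (+ 4) (mod-weaken m³∣[tm]³ (eₙ-shift≈ (t * m) xs)) ⟩
    + 4 * (a - b * (t * m) + c * (t * m * (t * m)))
      ≡⟨ rearrange a b c m t ⟩
    T (+ 2 * t) ∎
    where
    open ≈-mod-Reasoning (m ^ 3)
    cube : ∀ t m → (t * m) * ((t * m) * ((t * m) * 1ℤ)) ≡ (t * t * t) * (m * (m * (m * 1ℤ)))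
    cube = solve-∀
    m³∣[tm]³ : m ^ 3 Signed.∣ (t * m) ^ 3
    m³∣[tm]³ = divides (t * t * t) (cube t m)
    rearrange : ∀ a b c m t → + 4 * (a - b * (t * m) + c * (t * m * (t * m)))
      ≡ + 4 * a - + 2 * (+ 2 * t) * (b * m) + + 2 * t * (+ 2 * t) * (c * (m * m))
    rearrange = solve-∀

  eₙ-shift-doubles≈T : + 4 * eₙ (map (_- m) (map (+ 2 *_) xs)) ≈ (+ 2) ^ length xs * T 1ℤ [mod m ^ 3 ]
  eₙ-shift-doubles≈T = begin
    + 4 * eₙ (map (_- m) ys)
      ≈⟨ *-congˡ-mod (+ 4) (eₙ-shift≈ m ys) ⟩
    + 4 * (eₙ ys - eₙ₋₁ ys * m + eₙ₋₂ ys * (m * m))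
      ≡⟨ rearrange (eₙ ys) (eₙ₋₁ ys) (eₙ₋₂ ys) m ⟩
    + 4 * eₙ ys - + 2 * (+ 2 * eₙ₋₁ ys) * m + + 2 * + 2 * eₙ₋₂ ys * (m * m)
      ≡⟨ cong₂ (λ e f → + 4 * e - + 2 * f * m + + 2 * + 2 * eₙ₋₂ ys * (m * m))
               (eₙ-map-* (+ 2) xs) (eₙ₋₁-map-* (+ 2) xs) ⟩
    + 4 * (X * a) - + 2 * (X * b) * m + + 2 * + 2 * eₙ₋₂ ys * (m * m)
      ≡⟨ cong (λ g → + 4 * (X * a) - + 2 * (X * b) * m + g * (m * m)) (eₙ₋₂-map-* (+ 2) xs) ⟩
    + 4 * (X * a) - + 2 * (X * b) * m + X * c * (m * m)
      ≡⟨ factor X a b c m ⟩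
    X * T 1ℤ ∎
    where
    open ≈-mod-Reasoning (m ^ 3)
    ys : List ℤ
    ys = map (+ 2 *_) xs
    X : ℤ
    X = (+ 2) ^ length xs
    rearrange : ∀ e f g m → + 4 * (e - f * m + g * (m * m)) ≡ + 4 * e - + 2 * (+ 2 * f) * m + + 2 * + 2 * g * (m * m)
    rearrange = solve-∀
    factor : ∀ X a b c m → + 4 * (X * a) - + 2 * (X * b) * m + X * c * (m * m)
      ≡ X * (+ 4 * a - + 2 * 1ℤ * (b * m) + 1ℤ * 1ℤ * (c * (m * m)))
    factor = solve-∀

-- Half of the residues modulo an odd number

module HalfResidues (h : ℕ) where

  p : ℕ
  p = suc (h ℕ.+ h)

  P X : ℤ
  P = + p
  X = (+ 2) ^ h

  U E : List ℤ
  U = oneTo h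
  E = map (+ 2 *_) U

  reflect : List ℤ → List ℤ
  reflect = map (λ x → P - x)

  private
    upper odds evens : List ℤ
    upper = applyUpTo (λ i → + suc (h ℕ.+ i)) h
    odds  = applyUpTo (λ i → + suc (i ℕ.+ i)) h
    evens = applyUpTo (λ i → + suc (suc (i ℕ.+ i))) h

    E≡ : E ≡ applyUpTo (λ i → + 2 * + suc i) h
    E≡ = map-applyUpTo (λ i → + suc i) (+ 2 *_) h

    upper-complement : ∀ {i} → i ℕ.< h → suc (h ℕ.+ (h ∸ suc i)) ℕ.+ suc i ≡ p
    upper-complement {i} i<h =
      trans (cong suc (ℕ.+-assoc h (h ∸ suc i) (suc i))) (cong (λ x → suc (h ℕ.+ x)) (ℕ.m∸n+n≡m i<h))

    odd-complement : ∀ {i} → i ℕ.< h → suc ((h ∸ suc i) ℕ.+ (h ∸ suc i)) ℕ.+ 2 ℕ.* suc i ≡ p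
    odd-complement {i} i<h = subst (λ x → suc ((h ∸ suc i) ℕ.+ (h ∸ suc i)) ℕ.+ 2 ℕ.* suc i ≡ suc (x ℕ.+ x))
      (ℕ.m∸n+n≡m i<h) (identity (h ∸ suc i) i)
      where identity : ∀ d i → suc (d ℕ.+ d) ℕ.+ 2 ℕ.* suc i ≡ suc ((d ℕ.+ suc i) ℕ.+ (d ℕ.+ suc i))
            identity = ℕ-Solver.solve-∀

    upper↭ : upper ↭ reflect U
    upper↭ = applyUpTo-reflect-↭ P (λ i → + suc i) (λ j → + suc (h ℕ.+ j)) h
      (λ i<h → pos-≡-minus (upper-complement i<h))

    odds↭ : odds ↭ reflect E
    odds↭ = subst (odds ↭_) (cong reflect (sym E≡))
      (applyUpTo-reflect-↭ P (λ i → + 2 * + suc i) (λ j → + suc (j ℕ.+ j)) h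
        (λ {i} i<h → trans (pos-≡-minus (odd-complement i<h)) (cong (λ x → P - x) (ℤ.pos-* 2 (suc i)))))

    evens≡E : evens ≡ E
    evens≡E = trans (applyUpTo-cong h (λ {i} _ → trans (cong +_ (double i)) (ℤ.pos-* 2 (suc i)))) (sym E≡)
      where double : ∀ i → suc (suc (i ℕ.+ i)) ≡ 2 ℕ.* suc i
            double = ℕ-Solver.solve-∀

  -- Both sides list 1, 2, …, p − 1.
  halves-↭ : U ++ reflect U ↭ E ++ reflect E
  halves-↭ = begin
    U ++ reflect U   ↭⟨ ++⁺ˡ U (↭.↭-sym upper↭) ⟩
    U ++ upper       ≡⟨ applyUpTo-++ (λ i → + suc i) h h ⟨
    oneTo (h ℕ.+ h)  ↭⟨ applyUpTo-interleave-↭ (λ i → + suc i) h ⟩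
    odds ++ evens    ↭⟨ ++-comm odds evens ⟩
    evens ++ odds    ≡⟨ cong (_++ odds) evens≡E ⟩
    E ++ odds        ↭⟨ ++⁺ˡ E odds↭ ⟩
    E ++ reflect E   ∎
    where open ↭.PermutationReasoning

  open QuadraticApproximation P U public

  length-U : length U ≡ h
  length-U = length-applyUpTo (λ i → + suc i) h

  length-E : length E ≡ h
  length-E = trans (length-map (+ 2 *_) U) length-U

  eₙ-E : eₙ E ≡ X * a
  eₙ-E = trans (eₙ-map-* (+ 2) U) (cong (λ n → (+ 2) ^ n * a) length-U)

  eₙ-reflect-U≡ : eₙ (reflect U) ≡ X * eₙ (reflect E)
  eₙ-reflect-U≡ = ℤ.*-cancelˡ-≡ a _ _ (begin
    a * eₙ (reflect U)        ≡⟨ eₙ-++ U (reflect U) ⟨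
    eₙ (U ++ reflect U)       ≡⟨ eₙ-↭ halves-↭ ⟩
    eₙ (E ++ reflect E)       ≡⟨ eₙ-++ E (reflect E) ⟩
    eₙ E * eₙ (reflect E)     ≡⟨ cong (_* eₙ (reflect E)) eₙ-E ⟩
    X * a * eₙ (reflect E)    ≡⟨ swap X a (eₙ (reflect E)) ⟩
    a * (X * eₙ (reflect E))  ∎)
    where
    open ≡-Reasoning
    instance _ = subst ℤ.NonZero (sym (eₙ-oneTo h)) (h ℕ.!≢0)
    swap : ∀ x y z → x * y * z ≡ y * (x * z)
    swap = solve-∀

  eₙ-shift-U≡ : eₙ (map (_- P) U) ≡ X * eₙ (map (_- P) E)
  eₙ-shift-U≡ = begin
    eₙ (map (_- P) U)
      ≡⟨ eₙ-map-neg P U ⟩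
    (- 1ℤ) ^ length U * eₙ (reflect U)
      ≡⟨ cong₂ (λ n e → (- 1ℤ) ^ n * e) (trans length-U (sym length-E)) eₙ-reflect-U≡ ⟩
    (- 1ℤ) ^ length E * (X * eₙ (reflect E))
      ≡⟨ swap ((- 1ℤ) ^ length E) X (eₙ (reflect E)) ⟩
    X * ((- 1ℤ) ^ length E * eₙ (reflect E))
      ≡⟨ cong (X *_) (eₙ-map-neg P E) ⟨
    X * eₙ (map (_- P) E) ∎
    where
    open ≡-Reasoning
    swap : ∀ x y z → x * (y * z) ≡ y * (x * z)
    swap = solve-∀

  2eₙ₋₁-E : + 2 * eₙ₋₁ E ≡ X * b
  2eₙ₋₁-E = trans (eₙ₋₁-map-* (+ 2) U) (cong (λ n → (+ 2) ^ n * b) length-U)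

  4eₙ₋₂-E : + 2 * + 2 * eₙ₋₂ E ≡ X * c
  4eₙ₋₂-E = trans (eₙ₋₂-map-* (+ 2) U) (cong (λ n → (+ 2) ^ n * c) length-U)

  eₙ-shift-E≈XT1 : + 4 * eₙ (map (_- P) E) ≈ X * T 1ℤ [mod P ^ 3 ]
  eₙ-shift-E≈XT1 = subst (λ n → + 4 * eₙ (map (_- P) E) ≈ (+ 2) ^ n * T 1ℤ [mod P ^ 3 ]) length-U eₙ-shift-doubles≈T

  module _ (pr : Prime p) (p≥5 : 5 ℕ.≤ p) where

    private
      p∤2 : ¬ (+ p ∣ + 2)
      p∤2 = prime∤-< (ℕ.s≤s ℕ.z≤n) (ℕ.<-≤-trans (ℕ.s≤s (ℕ.s≤s (ℕ.s≤s ℕ.z≤n))) p≥5)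

      p∤3 : ¬ (+ p ∣ + 3)
      p∤3 = prime∤-< (ℕ.s≤s ℕ.z≤n) (ℕ.<-≤-trans (ℕ.s≤s (ℕ.s≤s (ℕ.s≤s (ℕ.s≤s ℕ.z≤n)))) p≥5)

      p∤a : ¬ (+ p ∣ a)
      p∤a = subst (λ x → ¬ (+ p ∣ x)) (sym (eₙ-oneTo h)) (prime∤! h pr (ℕ.s≤s (ℕ.m≤m+n h h)))

      SU SE : List ℤ
      SU = squares U
      SE = squares E

      squares-halves-↭ : SU ++ squares (reflect U) ↭ SE ++ squares (reflect E)
      squares-halves-↭ = subst₂ _↭_ (map-++ (λ x → x * x) U (reflect U)) (map-++ (λ x → x * x) E (reflect E))
        (↭ₚ.map⁺ (λ x → x * x) halves-↭)

      doubled-squares≈ : (f : List ℤ → ℤ) → (∀ {xs ys} → Pointwise _≈_[mod P ] xs ys → f xs ≈ f ys [mod P ]) →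
        (∀ {xs ys} → xs ↭ ys → f xs ≡ f ys) → f (SU ++ SU) ≈ f (SE ++ SE) [mod P ]
      doubled-squares≈ f f-cong f-↭ = begin
        f (SU ++ SU)
          ≈⟨ f-cong (Pointwise.++⁺ˡ (mod-refl {P}) SU (Pointwise.symmetric mod-sym (squares-reflect≈ P U))) ⟩
        f (SU ++ squares (reflect U))
          ≡⟨ f-↭ squares-halves-↭ ⟩
        f (SE ++ squares (reflect E))
          ≈⟨ f-cong (Pointwise.++⁺ˡ (mod-refl {P}) SE (squares-reflect≈ P E)) ⟩
        f (SE ++ SE) ∎
        where open ≈-mod-Reasoning P

      X⁴≈1 : X * X * (X * X) ≈ 1ℤ [mod P ]
      X⁴≈1 = *-cancelˡ-mod-prime {c = a * a * (a * a)} pr (prime∤*ℤ pr (a * a) (a * a) a²∤ a²∤) (begin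
        a * a * (a * a) * (X * X * (X * X))  ≡⟨ rearrange a X ⟩
        X * a * (X * a) * (X * a * (X * a))  ≡⟨ cong (λ e → e * e * (e * e)) eₙ-E ⟨
        eₙ E * eₙ E * (eₙ E * eₙ E)          ≡⟨ eₙ-doubled E ⟨
        eₙ (SE ++ SE)                        ≈⟨ mod-sym (doubled-squares≈ eₙ eₙ-cong-mod eₙ-↭) ⟩
        eₙ (SU ++ SU)                        ≡⟨ eₙ-doubled U ⟩
        a * a * (a * a)                      ≡⟨ ℤ.*-identityʳ (a * a * (a * a)) ⟨
        a * a * (a * a) * 1ℤ                 ∎)
        where
        open ≈-mod-Reasoning P
        a²∤ : ¬ (+ p ∣ a * a)
        a²∤ = prime∤*ℤ pr a a p∤a p∤a
        rearrange : ∀ a X → a * a * (a * a) * (X * X * (X * X)) ≡ X * a * (X * a) * (X * a * (X * a))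
        rearrange = solve-∀

      -- d = (h!)² Σ_{j ≤ h} j⁻²
      d : ℤ
      d = eₙ₋₁ SU

      4eₙ₋₁-SE : + 4 * eₙ₋₁ SE ≡ X * X * d
      4eₙ₋₁-SE = begin
        + 4 * eₙ₋₁ SE
          ≡⟨ cong (+ 4 *_) (eₙ₋₁-squares E) ⟨
        + 4 * (eₙ₋₁ E * eₙ₋₁ E - + 2 * eₙ E * eₙ₋₂ E)
          ≡⟨ rearrange (eₙ E) (eₙ₋₁ E) (eₙ₋₂ E) ⟩
        + 2 * eₙ₋₁ E * (+ 2 * eₙ₋₁ E) - + 2 * eₙ E * (+ 2 * + 2 * eₙ₋₂ E)
          ≡⟨ cong₂ (λ s t → s * s - + 2 * eₙ E * t) 2eₙ₋₁-E 4eₙ₋₂-E ⟩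
        X * b * (X * b) - + 2 * eₙ E * (X * c)
          ≡⟨ cong (λ e → X * b * (X * b) - + 2 * e * (X * c)) eₙ-E ⟩
        X * b * (X * b) - + 2 * (X * a) * (X * c)
          ≡⟨ factor X a b c ⟩
        X * X * (b * b - + 2 * a * c)
          ≡⟨ cong (X * X *_) (eₙ₋₁-squares U) ⟩
        X * X * d ∎
        where
        open ≡-Reasoning
        rearrange : ∀ e f g → + 4 * (f * f - + 2 * e * g) ≡ + 2 * f * (+ 2 * f) - + 2 * e * (+ 2 * + 2 * g)
        rearrange = solve-∀
        factor : ∀ X a b c → X * b * (X * b) - + 2 * (X * a) * (X * c) ≡ X * X * (b * b - + 2 * a * c)
        factor = solve-∀

      4d≈d : + 4 * d ≈ d [mod P ]
      4d≈d = *-cancelˡ-mod-prime {c = + 2 * (a * a)} pr 2a²∤ (begin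
        + 2 * (a * a) * (+ 4 * d)              ≡⟨ swap (+ 2 * (a * a)) (+ 4) d ⟩
        + 4 * (+ 2 * (a * a) * d)              ≡⟨ cong (+ 4 *_) (eₙ₋₁-doubled U) ⟨
        + 4 * eₙ₋₁ (SU ++ SU)                  ≈⟨ *-congˡ-mod (+ 4) (doubled-squares≈ eₙ₋₁ eₙ₋₁-cong-mod eₙ₋₁-↭) ⟩
        + 4 * eₙ₋₁ (SE ++ SE)                  ≡⟨ cong (+ 4 *_) (eₙ₋₁-doubled E) ⟩
        + 4 * (+ 2 * (eₙ E * eₙ E) * eₙ₋₁ SE)  ≡⟨ cong (λ e → + 4 * (+ 2 * (e * e) * eₙ₋₁ SE)) eₙ-E ⟩
        + 4 * (+ 2 * (X * a * (X * a)) * eₙ₋₁ SE) ≡⟨ rearrange X a (eₙ₋₁ SE) ⟩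
        + 2 * (a * a) * (X * X * (+ 4 * eₙ₋₁ SE)) ≡⟨ cong (λ g → + 2 * (a * a) * (X * X * g)) 4eₙ₋₁-SE ⟩
        + 2 * (a * a) * (X * X * (X * X * d))  ≡⟨ cong (+ 2 * (a * a) *_) (ℤ.*-assoc (X * X) (X * X) d) ⟨
        + 2 * (a * a) * (X * X * (X * X) * d)  ≈⟨ *-congˡ-mod (+ 2 * (a * a)) (*-cong-mod X⁴≈1 (mod-refl {P} {d})) ⟩
        + 2 * (a * a) * (1ℤ * d)               ≡⟨ cong (+ 2 * (a * a) *_) (ℤ.*-identityˡ d) ⟩
        + 2 * (a * a) * d                      ∎)
        where
        open ≈-mod-Reasoning P
        2a²∤ : ¬ (+ p ∣ + 2 * (a * a))
        2a²∤ = prime∤*ℤ pr (+ 2) (a * a) p∤2 (prime∤*ℤ pr a a p∤a p∤a)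
        swap : ∀ x y z → x * (y * z) ≡ y * (x * z)
        swap = solve-∀
        rearrange : ∀ X a f → + 4 * (+ 2 * (X * a * (X * a)) * f) ≡ + 2 * (a * a) * (X * X * (+ 4 * f))
        rearrange = solve-∀

    p∣b²-2ac : P Signed.∣ (b * b - + 2 * a * c)
    p∣b²-2ac = subst (P Signed.∣_) (sym (eₙ₋₁-squares U)) (∣ᵤ⇒∣ p∣d)
      where
      three : ∀ d → + 4 * d - d ≡ + 3 * d
      three = solve-∀
      p∣d : + p ∣ d
      p∣d = prime∣*ℤ⇒∣ pr (+ 3) d p∤3 (subst (+ p ∣_) (three d) (≈⇒≡-mod 4d≈d))

    private
      F : ℤ
      F = + 4 * a

      p∤F : ¬ (+ p ∣ F)
      p∤F = prime∤*ℤ pr (+ 4) a (prime∤*ℤ pr (+ 2) (+ 2) p∤2 p∤2) p∤a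

      T1≈F : T 1ℤ ≈ F [mod P ]
      T1≈F = ≡⇒≈-mod (c * P - + 2 * b) (reduce a b c P)
        where reduce : ∀ a b c P → + 4 * a - + 2 * 1ℤ * (b * P) + 1ℤ * 1ℤ * (c * (P * P)) - + 4 * a ≡ (c * P - + 2 * b) * P
              reduce = solve-∀

      T1≈FX² : T 1ℤ ≈ F * (X * X) [mod P ^ 3 ]
      T1≈FX² = *-cancelˡ-mod-prime^ {c = T 1ℤ} 3 pr (mod-∤ T1≈F p∤F) (begin
        T 1ℤ * T 1ℤ                          ≈⟨ T-mul p∣b²-2ac 1ℤ 1ℤ ⟩
        F * T (+ 2 * 1ℤ)                     ≈⟨ *-congˡ-mod F (mod-sym (eₙ-shift≈T 1ℤ)) ⟩
        F * (+ 4 * eₙ (map (_- 1ℤ * P) U))   ≡⟨ cong (λ x → F * (+ 4 * eₙ (map (_- x) U))) (ℤ.*-identityˡ P) ⟩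
        F * (+ 4 * eₙ (map (_- P) U))        ≡⟨ cong (λ e → F * (+ 4 * e)) eₙ-shift-U≡ ⟩
        F * (+ 4 * (X * eₙ (map (_- P) E)))  ≡⟨ cong (F *_) (swap (+ 4) X (eₙ (map (_- P) E))) ⟩
        F * (X * (+ 4 * eₙ (map (_- P) E)))  ≈⟨ *-congˡ-mod F (*-congˡ-mod X eₙ-shift-E≈XT1) ⟩
        F * (X * (X * T 1ℤ))                 ≡⟨ rearrange F X (T 1ℤ) ⟩
        T 1ℤ * (F * (X * X))                 ∎)
        where
        open ≈-mod-Reasoning (P ^ 3)
        swap : ∀ x y z → x * (y * z) ≡ y * (x * z)
        swap = solve-∀
        rearrange : ∀ F X t → F * (X * (X * t)) ≡ t * (F * (X * X))
        rearrange = solve-∀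

      eₙ-shift-binomial : ∀ k₀ →
        eₙ (map (_- + suc k₀ * P) U) ≡ (- 1ℤ) ^ h * (+ ((suc k₀ ℕ.* p ∸ 1) C h) * + (h !))
      eₙ-shift-binomial k₀ = begin
        eₙ (map (_- + suc k₀ * P) U)
          ≡⟨ eₙ-map-neg (+ suc k₀ * P) U ⟩
        (- 1ℤ) ^ length U * eₙ (map (λ j → + suc k₀ * P - j) U)
          ≡⟨ cong₂ (λ l x → (- 1ℤ) ^ l * eₙ (map (λ j → x - j) U)) length-U (sym (ℤ.pos-* (suc k₀) p)) ⟩
        (- 1ℤ) ^ h * eₙ (map (λ j → + (suc k₀ ℕ.* p) - j) U)
          ≡⟨ cong ((- 1ℤ) ^ h *_) (eₙ-reflect-oneTo h≤n) ⟩
        (- 1ℤ) ^ h * (+ ((suc k₀ ℕ.* p ∸ 1) C h) * + (h !)) ∎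
        where
        open ≡-Reasoning
        h≤n : h ℕ.≤ suc k₀ ℕ.* p ∸ 1
        h≤n = ℕ.≤-trans (ℕ.m≤m+n h h) (ℕ.m≤m+n (h ℕ.+ h) (k₀ ℕ.* p))

    binomial≈ : ∀ k₀ →
      (- 1ℤ) ^ h * + ((suc k₀ ℕ.* p ∸ 1) C h) ≈ (+ 4) ^ (suc k₀ ℕ.* (h ℕ.+ h)) [mod P ^ 3 ]
    binomial≈ k₀ = begin
      s * B     ≈⟨ mod-sym (*-cancelˡ-mod-prime^ {c = F} 3 pr p∤F
                     (*-cancelˡ-mod-prime^ {c = F ^ n} 3 pr (prime∤^ℤ pr F n p∤F) scaled)) ⟩
      W         ≡⟨ W≡4^ ⟩
      (+ 4) ^ (k ℕ.* (h ℕ.+ h)) ∎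
      where
      open ≈-mod-Reasoning (P ^ 3)
      k n : ℕ
      k = suc k₀
      n = k ℕ.+ k
      s B W : ℤ
      s = (- 1ℤ) ^ h
      B = + ((k ℕ.* p ∸ 1) C h)
      W = (X * X) ^ n
      T0≡4a : ∀ a b c P → + 4 * a - + 2 * 0ℤ * (b * P) + 0ℤ * 0ℤ * (c * (P * P)) ≡ + 4 * a
      T0≡4a = solve-∀
      double : ∀ x → x + x ≡ + 2 * x
      double = solve-∀
      swap : ∀ x y z → x * (y * z) ≡ y * (x * z)
      swap = solve-∀
      rearrange : ∀ a s B → + 4 * (s * (B * a)) ≡ + 4 * a * (s * B)
      rearrange = solve-∀
      scaled : F ^ n * (F * W) ≈ F ^ n * (F * (s * B)) [mod P ^ 3 ]
      scaled = begin
        F ^ n * (F * W)                           ≡⟨ swap (F ^ n) F W ⟩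
        F * (F ^ n * W)                           ≡⟨ cong (F *_) (^-distribʳ-* F (X * X) n) ⟨
        F * (F * (X * X)) ^ n                     ≈⟨ *-congˡ-mod F (^-cong-mod n (mod-sym T1≈FX²)) ⟩
        F * T 1ℤ ^ n                              ≈⟨ power-law T (T0≡4a a b c P) (T-mul p∣b²-2ac) n ⟩
        F ^ n * T (+ n)                           ≡⟨ cong (λ t → F ^ n * T t) (trans (ℤ.pos-+ k k) (double (+ k))) ⟩
        F ^ n * T (+ 2 * + k)                     ≈⟨ *-congˡ-mod (F ^ n) (mod-sym (eₙ-shift≈T (+ k))) ⟩
        F ^ n * (+ 4 * eₙ (map (_- + k * P) U))   ≡⟨ cong (λ e → F ^ n * (+ 4 * e)) (eₙ-shift-binomial k₀) ⟩
        F ^ n * (+ 4 * (s * (B * + (h !))))       ≡⟨ cong (λ x → F ^ n * (+ 4 * (s * (B * x)))) (eₙ-oneTo h) ⟨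
        F ^ n * (+ 4 * (s * (B * a)))             ≡⟨ cong (F ^ n *_) (rearrange a s B) ⟩
        F ^ n * (F * (s * B))                     ∎
      W≡4^ : W ≡ (+ 4) ^ (k ℕ.* (h ℕ.+ h))
      W≡4^ = trans (cong (_^ n) (sym (^-distribʳ-* (+ 2) (+ 2) h)))
               (trans (ℤ.^-*-assoc (+ 4) h n) (cong ((+ 4) ^_) (exponent h k)))
        where exponent : ∀ h k → h ℕ.* (k ℕ.+ k) ≡ k ℕ.* (h ℕ.+ h)
              exponent = ℕ-Solver.solve-∀

[n+n]/2≡n : ∀ n → (n ℕ.+ n) / 2 ≡ n
[n+n]/2≡n n = trans (cong (_/ 2) (sym (n*2≡n+n n))) (m*n/n≡m n 2)

corollary4 : (p k : ℕ) → Prime p → 5 ℕ.≤ p → .{{_ : NonZero k}} →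
    ((-[1+ 0 ] ^ ((p ∸ 1) / 2)) * (+ ((k ℕ.* p ∸ 1) C ((p ∸ 1) / 2))))
    ≡ ((+ 4) ^ (k ℕ.* (p ∸ 1))) [mod ((+ p) ^ 3) ]
corollary4 p (suc k₀) pr p≥5 with prime>2⇒odd pr (ℕ.<-≤-trans (ℕ.s≤s (ℕ.s≤s (ℕ.s≤s ℕ.z≤n))) p≥5)
... | h , refl rewrite [n+n]/2≡n h = ≈⇒≡-mod (HalfResidues.binomial≈ h pr p≥5 k₀)
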